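{- Let $\mathbf{v}=(v_1,\dots,v_m)$ and $\mathbf{k}=(k_1,\dots,k_m)$ be $m$-tuples of positive integers with $\mathbf{v}\ge\mathbf{k}$, and let $\mathbf{w}=(w_1,\dots,w_n)$ and $\boldsymbol{\ell}=(\ell_1,\dots,\ell_n)$ be $n$-tuples of positive integers with $\mathbf{w}\ge\boldsymbol{\ell}$. Then for every integer $t$ with $1\le t\le\min\{\sum_i k_i,\sum_j\ell_j\}$, \[ C(\mathrm{cat}(\mathbf{v},\mathbf{w}),\mathrm{cat}(\mathbf{k},\boldsymbol{\ell}),t)\le \max\{C(\mathbf{v},\mathbf{k},t),C(\mathbf{w},\boldsymbol{\ell},t)\}+C(\mathbf{v},\mathbf{k},t-1)\,C(\mathbf{w},\boldsymbol{\ell},t-1), \] with the convention $C(\mathbf{v},\mathbf{k},0)=C(\mathbf{w},\boldsymbol{\ell},0)=0$.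
   Context: $\mathbf{x}\ge\mathbf{y}$ means componentwise. For tuples $\mathbf{a}=(a_1,\dots,a_p)$, $\mathbf{b}=(b_1,\dots,b_q)$, $\mathrm{cat}(\mathbf{a},\mathbf{b})=(a_1,\dots,a_p,b_1,\dots,b_q)$. Generalized covering designs: for $p$-tuples of positive integers $\mathbf{v}=(v_1,\dots,v_p)$, $\mathbf{k}=(k_1,\dots,k_p)$ with $k_i\le v_i$ and an integer $t$ with $1\le t\le \sum_i k_i$, let $X_1,\dots,X_p$ be pairwise disjoint sets with $|X_i|=v_i$. A block is a $p$-tuple $(B_1,\dots,B_p)$ with $B_i\subseteq X_i$, $|B_i|=k_i$. A $p$-tuple of sets $(T_1,\dots,T_p)$ is $(\mathbf{v},\mathbf{k},t)$-admissible if $T_i\subseteq X_i$, $|T_i|\le k_i$ and $\sum_i|T_i|=t$; it is contained in a block if $T_i\subseteq B_i$ for all $i$. A ${\rm GC}(\mathbf{v},\mathbf{k},t)$ is a family of blocks (repetitions allowed) such that every admissible tuple is contained in at least one block, and $C(\mathbf{v},\mathbf{k},t)$ is the minimum number of blocks of a ${\rm GC}(\mathbf{v},\mathbf{k},t)$. -}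

module Defs where

open import Data.Nat using (ℕ; zero; suc; _≤_)
open import Data.Fin using (Fin)
open import Data.Fin.Subset using (Subset; _⊆_; ∣_∣)
open import Data.Vec using (Vec; lookup; tabulate; sum)
open import Data.List using (List; length)
open import Data.List.Relation.Unary.All using (All)
open import Data.List.Relation.Unary.Any using (Any)
open import Data.Product using (Σ; _×_)
open import Relation.Binary.PropositionalEquality using (_≡_)

-- The ground sets: X_i = Fin (v_i); disjointness is implicit since the
-- i-th component of a tuple lives in its own index i.
-- A p-tuple of subsets (T_1,...,T_p) with T_i ⊆ X_i.
Tuple : ∀ {p} → Vec ℕ p → Set
Tuple {p} v = (i : Fin p) → Subset (lookup v i)

IsBlock : ∀ {p} (v k : Vec ℕ p) → Tuple v → Set
IsBlock v k B = ∀ i → ∣ B i ∣ ≡ lookup k i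

Admissible : ∀ {p} (v k : Vec ℕ p) (t : ℕ) → Tuple v → Set
Admissible v k t T =
  (∀ i → ∣ T i ∣ ≤ lookup k i) × (sum (tabulate (λ i → ∣ T i ∣)) ≡ t)

ContainedIn : ∀ {p} {v : Vec ℕ p} → Tuple v → Tuple v → Set
ContainedIn T B = ∀ i → T i ⊆ B i

IsGC : ∀ {p} (v k : Vec ℕ p) (t : ℕ) → List (Tuple v) → Set
IsGC v k t F =
  All (IsBlock v k) F × (∀ T → Admissible v k t T → Any (ContainedIn {v = v} T) F)

IsCoveringNumber : ∀ {p} (v k : Vec ℕ p) (t : ℕ) → ℕ → Set
IsCoveringNumber v k t c =
  Σ (List (Tuple v)) (λ F → IsGC v k t F × length F ≡ c)
  × (∀ F → IsGC v k t F → c ≤ length F)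

CValue : ∀ {p} (v k : Vec ℕ p) (t : ℕ) → ℕ → Set
CValue v k zero c = c ≡ 0
CValue v k (suc t) c = IsCoveringNumber v k (suc t) c

-- Cover the tuples of sum t in cat(v,w) according to how they split. If the
-- right part is empty, the left part is (v,k,t)-admissible and lies in a block
-- of a GC(v,k,t); symmetrically if the left part is empty. Pairing the blocks of
-- an optimal GC(v,k,t) and GC(w,l,t) position by position, padding the shorter
-- list with an arbitrary fixed block, handles both cases with max(a,b) blocks.
-- If both parts are nonempty, each has at most t-1 elements, and a GC(·,·,t-1)
-- also covers every smaller admissible tuple (extend it to size t-1 first), so
-- all c·d concatenations of blocks of the two (t-1)-coverings finish the job.
module Submission where

open import Defs
open import Data.Nat using (ℕ; _≤_; _+_; _*_; _⊔_; _∸_)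
open import Data.Fin using (Fin)
open import Data.Vec using (Vec; lookup; sum; _++_)

open import Data.Nat using (zero; suc; s≤s; _<_; _≟_)
open import Data.Nat.Properties
open import Data.Bool using (true; false)
open import Data.Fin using (zero; suc)
open import Data.Vec using ([]; _∷_; tabulate; there)
open import Data.Fin.Subset using (Subset; _⊆_; ∣_∣; ⊥)
open import Data.Fin.Subset.Properties using (∣⊥∣≡0; s⊆s; out⊆)
open import Data.List using (List; []; _∷_; length; map; alignWith; cartesianProductWith)
  renaming (_++_ to _++ˡ_)
open import Data.List.Properties using (length-map; length-++; length-alignWith)
open import Data.List.Relation.Unary.All using (All; []; _∷_)
import Data.List.Relation.Unary.All as All
import Data.List.Relation.Unary.All.Properties as All
open import Data.List.Relation.Unary.Any using (Any; here; there)
import Data.List.Relation.Unary.Any as Any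
import Data.List.Relation.Unary.Any.Properties as Any
open import Data.These using (foldWithDefaults)
open import Data.Product using (Σ; _×_; _,_; proj₁; proj₂)
open import Data.Sum using (_⊎_; inj₁; inj₂)
open import Function using (_∘_; id)
open import Relation.Nullary using (yes; no; contradiction)
open import Relation.Binary.PropositionalEquality

private
  variable
    A B C : Set
    P Q R : A → Set

length-cartesianProductWith : (f : A → B → C) (xs : List A) (ys : List B) →
  length (cartesianProductWith f xs ys) ≡ length xs * length ys
length-cartesianProductWith f [] ys = refl
length-cartesianProductWith f (x ∷ xs) ys = begin
  length (map (f x) ys ++ˡ cartesianProductWith f xs ys)
    ≡⟨ length-++ (map (f x) ys) ⟩
  length (map (f x) ys) + length (cartesianProductWith f xs ys)
    ≡⟨ cong₂ _+_ (length-map (f x) ys) (length-cartesianProductWith f xs ys) ⟩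
  length ys + length xs * length ys ∎
  where open ≡-Reasoning

cartesianProductWith-All⁺ : (f : A → B → C) → (∀ {x y} → P x → Q y → R (f x y)) →
  ∀ {xs ys} → All P xs → All Q ys → All R (cartesianProductWith f xs ys)
cartesianProductWith-All⁺ f pres [] qys = []
cartesianProductWith-All⁺ f pres (px ∷ pxs) qys =
  All.++⁺ (All.map⁺ (All.map (pres px) qys)) (cartesianProductWith-All⁺ f pres pxs qys)

module _ (a : A) (b : B) (f : A → B → C) where

  alignWithDefaults : List A → List B → List C
  alignWithDefaults = alignWith (foldWithDefaults a b f)

  alignWithDefaults-All⁺ : (∀ {x y} → P x → Q y → R (f x y)) → P a → Q b →
    ∀ {xs ys} → All P xs → All Q ys → All R (alignWithDefaults xs ys)
  alignWithDefaults-All⁺ pres pa qb {[]} pxs qys = All.map⁺ (All.map (pres pa) qys)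
  alignWithDefaults-All⁺ pres pa qb {_ ∷ _} {[]} pxs qys =
    All.map⁺ (All.map (λ px → pres px qb) pxs)
  alignWithDefaults-All⁺ pres pa qb {_ ∷ _} {_ ∷ _} (px ∷ pxs) (qy ∷ qys) =
    pres px qy ∷ alignWithDefaults-All⁺ pres pa qb pxs qys

  alignWithDefaults-Anyˡ : (∀ {x} → P x → ∀ y → R (f x y)) →
    ∀ {xs} ys → Any P xs → Any R (alignWithDefaults xs ys)
  alignWithDefaults-Anyˡ pres {_ ∷ _} [] pxs = Any.map⁺ (Any.map (λ px → pres px b) pxs)
  alignWithDefaults-Anyˡ pres (y ∷ ys) (here px) = here (pres px y)
  alignWithDefaults-Anyˡ pres (y ∷ ys) (there pxs) = there (alignWithDefaults-Anyˡ pres ys pxs)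

  alignWithDefaults-Anyʳ : (∀ {y} → Q y → ∀ x → R (f x y)) →
    ∀ xs {ys} → Any Q ys → Any R (alignWithDefaults xs ys)
  alignWithDefaults-Anyʳ pres [] {_ ∷ _} qys = Any.map⁺ (Any.map (λ qy → pres qy a) qys)
  alignWithDefaults-Anyʳ pres (x ∷ xs) (here qy) = here (pres qy x)
  alignWithDefaults-Anyʳ pres (x ∷ xs) (there qys) = there (alignWithDefaults-Anyʳ pres xs qys)

subset-of-size : ∀ {n k} → k ≤ n → Σ (Subset n) λ p → ∣ p ∣ ≡ k
subset-of-size {n} {zero} _ = ⊥ , ∣⊥∣≡0 n
subset-of-size {suc n} {suc k} (s≤s k≤n) with subset-of-size k≤n
... | p , ∣p∣≡k = true ∷ p , cong suc ∣p∣≡k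

subset-grow : ∀ {n} (p : Subset n) → ∣ p ∣ < n →
  Σ (Subset n) λ q → p ⊆ q × ∣ q ∣ ≡ suc ∣ p ∣
subset-grow (true ∷ p) (s≤s ∣p∣<n) with subset-grow p ∣p∣<n
... | q , p⊆q , ∣q∣≡ = true ∷ q , s⊆s p⊆q , cong suc ∣q∣≡
subset-grow (false ∷ p) _ = true ∷ p , out⊆ id , refl

∣p∣≡0⇒p⊆q : ∀ {n} (p q : Subset n) → ∣ p ∣ ≡ 0 → p ⊆ q
∣p∣≡0⇒p⊆q (false ∷ p) (_ ∷ q) ∣p∣≡0 (there x∈p) =
  there (∣p∣≡0⇒p⊆q p q ∣p∣≡0 x∈p)

size : ∀ {p} (v : Vec ℕ p) → Tuple v → ℕ
size v T = sum (tabulate (λ i → ∣ T i ∣))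

Bounded : ∀ {p} (v k : Vec ℕ p) → Tuple v → Set
Bounded v k T = ∀ i → ∣ T i ∣ ≤ lookup k i

Contained : ∀ {p} (v : Vec ℕ p) → Tuple v → Tuple v → Set
Contained v = ContainedIn {v = v}

Fits : ∀ {p} (v k : Vec ℕ p) → Set
Fits v k = ∀ i → lookup k i ≤ lookup v i

consₜ : ∀ {x p} {v : Vec ℕ p} → Subset x → Tuple v → Tuple (x ∷ v)
consₜ s T zero = s
consₜ s T (suc i) = T i

consₜ-bounded : ∀ {x k₀ p} {v k : Vec ℕ p} {s : Subset x} {T : Tuple v} →
  ∣ s ∣ ≤ k₀ → Bounded v k T → Bounded (x ∷ v) (k₀ ∷ k) (consₜ s T)
consₜ-bounded ∣s∣≤k₀ bd zero = ∣s∣≤k₀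
consₜ-bounded ∣s∣≤k₀ bd (suc i) = bd i

consₜ-isBlock : ∀ {x k₀ p} {v k : Vec ℕ p} {s : Subset x} {T : Tuple v} →
  ∣ s ∣ ≡ k₀ → IsBlock v k T → IsBlock (x ∷ v) (k₀ ∷ k) (consₜ s T)
consₜ-isBlock ∣s∣≡k₀ isB zero = ∣s∣≡k₀
consₜ-isBlock ∣s∣≡k₀ isB (suc i) = isB i

consₜ-⊇ : ∀ {x p} {v : Vec ℕ p} {T : Tuple (x ∷ v)} {s : Subset x} {T′ : Tuple v} →
  T zero ⊆ s → Contained v (T ∘ suc) T′ → Contained (x ∷ v) T (consₜ s T′)
consₜ-⊇ T₀⊆s T⊆T′ zero = T₀⊆s
consₜ-⊇ T₀⊆s T⊆T′ (suc i) = T⊆T′ i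

Contained-trans : ∀ {p} (v : Vec ℕ p) {T U V : Tuple v} →
  Contained v T U → Contained v U V → Contained v T V
Contained-trans v T⊆U U⊆V i = U⊆V i ∘ T⊆U i

∃-block : ∀ {p} (v k : Vec ℕ p) → Fits v k → Σ (Tuple v) (IsBlock v k)
∃-block v k k≤v =
  (λ i → proj₁ (subset-of-size (k≤v i))) , (λ i → proj₂ (subset-of-size (k≤v i)))

size≡0⇒contained : ∀ {p} (v : Vec ℕ p) (T B : Tuple v) → size v T ≡ 0 → Contained v T B
size≡0⇒contained (x ∷ v) T B ∣T∣≡0 zero =
  ∣p∣≡0⇒p⊆q (T zero) (B zero) (m+n≡0⇒m≡0 ∣ T zero ∣ ∣T∣≡0)
size≡0⇒contained (x ∷ v) T B ∣T∣≡0 (suc i) =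
  size≡0⇒contained v (T ∘ suc) (B ∘ suc) (m+n≡0⇒n≡0 ∣ T zero ∣ ∣T∣≡0) i

Extension : ∀ {p} (v k : Vec ℕ p) → Tuple v → ℕ → Set
Extension v k T s = Σ (Tuple v) λ T′ → Contained v T T′ × Bounded v k T′ × size v T′ ≡ s

grow-tuple : ∀ {p} (v k : Vec ℕ p) → Fits v k → (T : Tuple v) → Bounded v k T →
  size v T < sum k → Extension v k T (suc (size v T))
grow-tuple (x ∷ v) (k₀ ∷ k) k≤v T bd ∣T∣<k with m≤n⇒m<n∨m≡n (bd zero)
... | inj₁ ∣T₀∣<k₀ with subset-grow (T zero) (≤-trans ∣T₀∣<k₀ (k≤v zero))
...   | s , T₀⊆s , ∣s∣≡ =
  consₜ s (T ∘ suc) , consₜ-⊇ T₀⊆s (λ _ → id) ,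
  consₜ-bounded (≤-trans (≤-reflexive ∣s∣≡) ∣T₀∣<k₀) (bd ∘ suc) ,
  cong (_+ size v (T ∘ suc)) ∣s∣≡
grow-tuple (x ∷ v) (k₀ ∷ k) k≤v T bd ∣T∣<k | inj₂ ∣T₀∣≡k₀
  with grow-tuple v k (k≤v ∘ suc) (T ∘ suc) (bd ∘ suc)
         (+-cancelˡ-< k₀ _ _ (subst (λ z → z + size v (T ∘ suc) < k₀ + sum k) ∣T₀∣≡k₀ ∣T∣<k))
... | T′ , T⊆T′ , bd′ , ∣T′∣≡ =
  consₜ (T zero) T′ , consₜ-⊇ id T⊆T′ , consₜ-bounded (bd zero) bd′ ,
  trans (cong (∣ T zero ∣ +_) ∣T′∣≡) (+-suc ∣ T zero ∣ _)

extend-tuple : ∀ {p} (v k : Vec ℕ p) → Fits v k → (T : Tuple v) → Bounded v k T →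
  ∀ {s} → size v T ≤ s → s ≤ sum k → Extension v k T s
extend-tuple v k k≤v T bd ∣T∣≤s s≤k with m≤n⇒m<n∨m≡n ∣T∣≤s
... | inj₂ ∣T∣≡s = T , (λ _ → id) , bd , ∣T∣≡s
extend-tuple v k k≤v T bd {suc s} _ s<k | inj₁ (s≤s ∣T∣≤s)
  with extend-tuple v k k≤v T bd ∣T∣≤s (<⇒≤ s<k)
... | T₁ , T⊆T₁ , bd₁ , refl with grow-tuple v k k≤v T₁ bd₁ s<k
... | T₂ , T₁⊆T₂ , bd₂ , ∣T₂∣≡ = T₂ , Contained-trans v T⊆T₁ T₁⊆T₂ , bd₂ , ∣T₂∣≡

IsGC-covers-smaller : ∀ {p} (v k : Vec ℕ p) → Fits v k → {r : ℕ} → r ≤ sum k →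
  {F : List (Tuple v)} → IsGC v k r F →
  (T : Tuple v) → Bounded v k T → size v T ≤ r → Any (Contained v T) F
IsGC-covers-smaller v k k≤v r≤k (_ , covers) T bd ∣T∣≤r
  with extend-tuple v k k≤v T bd ∣T∣≤r r≤k
... | T′ , T⊆T′ , bd′ , ∣T′∣≡r = Any.map (Contained-trans v T⊆T′) (covers T′ (bd′ , ∣T′∣≡r))

m+n≡1+o⇒m≤o : ∀ m {n o} → m + n ≡ suc o → 1 ≤ n → m ≤ o
m+n≡1+o⇒m≤o m {n} {o} m+n≡1+o 1≤n = ≤-pred (begin
  suc m  ≡⟨ +-comm 1 m ⟩
  m + 1  ≤⟨ +-monoʳ-≤ m 1≤n ⟩
  m + n  ≡⟨ m+n≡1+o ⟩
  suc o  ∎)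
  where open ≤-Reasoning

module _ {n} {w : Vec ℕ n} where

  left : ∀ {m} (v : Vec ℕ m) → Tuple (v ++ w) → Tuple v
  left [] T ()
  left (x ∷ v) T = consₜ (T zero) (left v (T ∘ suc))

  right : ∀ {m} (v : Vec ℕ m) → Tuple (v ++ w) → Tuple w
  right [] T = T
  right (x ∷ v) T = right v (T ∘ suc)

  join : ∀ {m} (v : Vec ℕ m) → Tuple v → Tuple w → Tuple (v ++ w)
  join [] A B = B
  join (x ∷ v) A B = consₜ (A zero) (join v (A ∘ suc) B)

  size-++ : ∀ {m} (v : Vec ℕ m) (T : Tuple (v ++ w)) →
    size (v ++ w) T ≡ size v (left v T) + size w (right v T)
  size-++ [] T = refl
  size-++ (x ∷ v) T =
    trans (cong (∣ T zero ∣ +_) (size-++ v (T ∘ suc))) (sym (+-assoc ∣ T zero ∣ _ _))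

  module _ {l : Vec ℕ n} where

    left-bounded : ∀ {m} (v k : Vec ℕ m) (T : Tuple (v ++ w)) →
      Bounded (v ++ w) (k ++ l) T → Bounded v k (left v T)
    left-bounded (x ∷ v) (k₀ ∷ k) T bd =
      consₜ-bounded (bd zero) (left-bounded v k (T ∘ suc) (bd ∘ suc))

    right-bounded : ∀ {m} (v k : Vec ℕ m) (T : Tuple (v ++ w)) →
      Bounded (v ++ w) (k ++ l) T → Bounded w l (right v T)
    right-bounded [] [] T bd = bd
    right-bounded (x ∷ v) (k₀ ∷ k) T bd = right-bounded v k (T ∘ suc) (bd ∘ suc)

    join-isBlock : ∀ {m} (v k : Vec ℕ m) {A : Tuple v} {B : Tuple w} →
      IsBlock v k A → IsBlock w l B → IsBlock (v ++ w) (k ++ l) (join v A B)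
    join-isBlock [] [] isA isB = isB
    join-isBlock (x ∷ v) (k₀ ∷ k) isA isB =
      consₜ-isBlock (isA zero) (join-isBlock v k (isA ∘ suc) isB)

  join-⊇ : ∀ {m} (v : Vec ℕ m) (T : Tuple (v ++ w)) {A : Tuple v} {B : Tuple w} →
    Contained v (left v T) A → Contained w (right v T) B → Contained (v ++ w) T (join v A B)
  join-⊇ [] T _ T⊆B = T⊆B
  join-⊇ (x ∷ v) T T⊆A T⊆B = consₜ-⊇ (T⊆A zero) (join-⊇ v (T ∘ suc) (T⊆A ∘ suc) T⊆B)

module _ {m n} (v k : Vec ℕ m) (w l : Vec ℕ n) (k≤v : Fits v k) (l≤w : Fits w l) where

  SplitCover : (Tuple (v ++ w) → Set) → ℕ → Set
  SplitCover Covered c = Σ (List (Tuple (v ++ w))) λ L →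
    All (IsBlock (v ++ w) (k ++ l)) L × length L ≡ c ×
    (∀ T → Covered T → Any (Contained (v ++ w) T) L)

  OneSided : Tuple (v ++ w) → Set
  OneSided T = size v (left v T) ≡ 0 ⊎ size w (right v T) ≡ 0

  one-sided-cover : ∀ {t F G} → IsGC v k t F → IsGC w l t G →
    SplitCover (λ T → Admissible (v ++ w) (k ++ l) t T × OneSided T) (length F ⊔ length G)
  one-sided-cover {t} {F} {G} (F-blocks , F-covers) (G-blocks , G-covers) =
    alignWithDefaults A₀ B₀ (join v) F G ,
    alignWithDefaults-All⁺ A₀ B₀ (join v) (join-isBlock v k)
      A₀-block B₀-block F-blocks G-blocks ,
    length-alignWith F G ,
    covers
    where
    A₀ : Tuple v
    A₀ = proj₁ (∃-block v k k≤v)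
    A₀-block : IsBlock v k A₀
    A₀-block = proj₂ (∃-block v k k≤v)
    B₀ : Tuple w
    B₀ = proj₁ (∃-block w l l≤w)
    B₀-block : IsBlock w l B₀
    B₀-block = proj₂ (∃-block w l l≤w)
    covers : ∀ T → Admissible (v ++ w) (k ++ l) t T × OneSided T →
      Any (Contained (v ++ w) T) (alignWithDefaults A₀ B₀ (join v) F G)
    covers T ((bd , ∣T∣≡t) , inj₁ ∣left∣≡0) =
      alignWithDefaults-Anyʳ A₀ B₀ (join v)
        (λ T⊆B A → join-⊇ v T (size≡0⇒contained v (left v T) A ∣left∣≡0) T⊆B) F
        (G-covers (right v T) (right-bounded v k T bd , (begin
          size w (right v T)                      ≡⟨ cong (_+ size w (right v T)) (sym ∣left∣≡0) ⟩
          size v (left v T) + size w (right v T)  ≡⟨ sym (size-++ v T) ⟩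
          size (v ++ w) T                         ≡⟨ ∣T∣≡t ⟩
          t                                       ∎)))
      where open ≡-Reasoning
    covers T ((bd , ∣T∣≡t) , inj₂ ∣right∣≡0) =
      alignWithDefaults-Anyˡ A₀ B₀ (join v)
        (λ T⊆A B → join-⊇ v T T⊆A (size≡0⇒contained w (right v T) B ∣right∣≡0)) G
        (F-covers (left v T) (left-bounded v k T bd , (begin
          size v (left v T)                       ≡⟨ sym (+-identityʳ _) ⟩
          size v (left v T) + 0                   ≡⟨ cong (size v (left v T) +_) (sym ∣right∣≡0) ⟩
          size v (left v T) + size w (right v T)  ≡⟨ sym (size-++ v T) ⟩
          size (v ++ w) T                         ≡⟨ ∣T∣≡t ⟩
          t                                       ∎)))
      where open ≡-Reasoning

  -- For s = 0 the list is empty, matching the convention C(·,·,0) = 0: no tuple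
  -- with a nonempty left part has at most 0 elements there.
  two-sided-cover : ∀ {s c d} → s ≤ sum k → s ≤ sum l → CValue v k s c → CValue w l s d →
    SplitCover (λ T → Bounded (v ++ w) (k ++ l) T × 1 ≤ size v (left v T)
                        × size v (left v T) ≤ s × size w (right v T) ≤ s)
               (c * d)
  two-sided-cover {zero} {d = d} _ _ c≡0 _ =
    [] , [] , sym (cong (_* d) c≡0) ,
    λ { T (_ , 1≤∣left∣ , ∣left∣≤0 , _) → contradiction (≤-trans 1≤∣left∣ ∣left∣≤0) λ () }
  two-sided-cover {suc s} s≤k s≤l ((F , F-gc , ∣F∣≡c) , _) ((G , G-gc , ∣G∣≡d) , _) =
    cartesianProductWith (join v) F G ,
    cartesianProductWith-All⁺ (join v) (join-isBlock v k) (proj₁ F-gc) (proj₁ G-gc) ,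
    trans (length-cartesianProductWith (join v) F G) (cong₂ _*_ ∣F∣≡c ∣G∣≡d) ,
    λ { T (bd , _ , ∣left∣≤s , ∣right∣≤s) →
      Any.cartesianProductWith⁺ (join v) (join-⊇ v T)
        (IsGC-covers-smaller v k k≤v s≤k F-gc (left v T) (left-bounded v k T bd) ∣left∣≤s)
        (IsGC-covers-smaller w l l≤w s≤l G-gc (right v T) (right-bounded v k T bd) ∣right∣≤s) }

  IsGC-++ : ∀ {t c d F G} → 1 ≤ t → t ≤ sum k → t ≤ sum l → IsGC v k t F → IsGC w l t G →
    CValue v k (t ∸ 1) c → CValue w l (t ∸ 1) d →
    Σ (List (Tuple (v ++ w))) λ L →
      IsGC (v ++ w) (k ++ l) t L × length L ≡ length F ⊔ length G + c * d
  IsGC-++ {suc s} _ t≤k t≤l F-gc G-gc c-val d-val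
    with one-sided-cover F-gc G-gc
       | two-sided-cover (≤-trans (n≤1+n s) t≤k) (≤-trans (n≤1+n s) t≤l) c-val d-val
  ... | L₁ , L₁-blocks , ∣L₁∣≡ , L₁-covers | L₂ , L₂-blocks , ∣L₂∣≡ , L₂-covers =
    L₁ ++ˡ L₂ , (All.++⁺ L₁-blocks L₂-blocks , covers) ,
    trans (length-++ L₁) (cong₂ _+_ ∣L₁∣≡ ∣L₂∣≡)
    where
    covers : ∀ T → Admissible (v ++ w) (k ++ l) (suc s) T →
      Any (Contained (v ++ w) T) (L₁ ++ˡ L₂)
    covers T adm@(bd , ∣T∣≡t) with size v (left v T) ≟ 0 | size w (right v T) ≟ 0
    ... | yes ∣left∣≡0 | _ = Any.++⁺ˡ (L₁-covers T (adm , inj₁ ∣left∣≡0))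
    ... | no _ | yes ∣right∣≡0 = Any.++⁺ˡ (L₁-covers T (adm , inj₂ ∣right∣≡0))
    ... | no ∣left∣≢0 | no ∣right∣≢0 = Any.++⁺ʳ L₁ (L₂-covers T
          (bd , n≢0⇒n>0 ∣left∣≢0 ,
           m+n≡1+o⇒m≤o _ split (n≢0⇒n>0 ∣right∣≢0) ,
           m+n≡1+o⇒m≤o _ (trans (+-comm (size w (right v T)) _) split) (n≢0⇒n>0 ∣left∣≢0)))
      where
      split : size v (left v T) + size w (right v T) ≡ suc s
      split = trans (sym (size-++ v T)) ∣T∣≡t

theorem6p3 : ∀ {m n} (v k : Vec ℕ m) (w l : Vec ℕ n)
    → (∀ i → 1 ≤ lookup v i) → (∀ i → 1 ≤ lookup k i) → (∀ i → lookup k i ≤ lookup v i)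
    → (∀ j → 1 ≤ lookup w j) → (∀ j → 1 ≤ lookup l j) → (∀ j → lookup l j ≤ lookup w j)
    → (t : ℕ) → 1 ≤ t → t ≤ sum k → t ≤ sum l
    → (a b c d e : ℕ)
    → IsCoveringNumber v k t a → IsCoveringNumber w l t b
    → CValue v k (t ∸ 1) c → CValue w l (t ∸ 1) d
    → IsCoveringNumber (v ++ w) (k ++ l) t e
    → e ≤ (a ⊔ b) + c * d
theorem6p3 v k w l _ _ k≤v _ _ l≤w t 1≤t t≤k t≤l a b c d e
  ((F , F-gc , ∣F∣≡a) , _) ((G , G-gc , ∣G∣≡b) , _) c-val d-val (_ , minimal)
  with IsGC-++ v k w l k≤v l≤w 1≤t t≤k t≤l F-gc G-gc c-val d-val
... | L , L-gc , ∣L∣≡ =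
  subst (e ≤_) (trans ∣L∣≡ (cong (_+ c * d) (cong₂ _⊔_ ∣F∣≡a ∣G∣≡b))) (minimal L L-gc)
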